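{- Let $\mathcal A$ be any collection of permutations from $S_n$. If $\mathcal A$ is not compressed, then it can be transformed into a compressed family by the application of a finite number of compression operations $\mathcal C_{i,j}$ ($1\le i<j\le n$).
   Context: $S_n$ is the symmetric group on $[n]=\{1,\dots,n\}$. For $\sigma\in S_n$ and $i<j$ in $[n]$, the $(i,j)$-compression $\sigma_{i,j}$ is defined by: if $\sigma(i)=i$ or $\sigma(j)\neq j$ then $\sigma_{i,j}=\sigma$; if $\sigma(i)\neq i$ and $\sigma(j)=j$ then $\sigma_{i,j}(i)=i$, $\sigma_{i,j}(j)=\sigma(i)$, $\sigma_{i,j}(\sigma^{ -1}(i))=j$, and $\sigma_{i,j}(y)=\sigma(y)$ for all other $y$. For a family $\mathcal A\subseteq S_n$, $\mathcal C_{i,j}(\mathcal A)=\{\mathcal C_{i,j}(\sigma):\sigma\in\mathcal A\}$ where $\mathcal C_{i,j}(\sigma)=\sigma_{i,j}$ if $\sigma_{i,j}\notin\mathcal A$ and $\mathcal C_{i,j}(\sigma)=\sigma$ otherwise. A family $\mathcal A$ is compressed if $\mathcal C_{i,j}(\mathcal A)=\mathcal A$ for all $1\le i<j\le n$. -}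

module Defs where

open import Data.Nat using (ℕ)
open import Data.Fin using (Fin; _<_)
open import Data.Fin.Properties using (_≟_; all?)
open import Data.List using (List; []; _∷_; map; foldl)
open import Data.List.Relation.Unary.Any using (Any; any?)
open import Data.Product using (Σ; _×_; _,_; proj₁; proj₂)
open import Relation.Nullary using (Dec; yes; no; ¬_)
open import Relation.Binary.PropositionalEquality using (_≡_; _≗_)
open import Function.Definitions using (Bijective)

-- A map [n] → [n]; elements of S_n are the bijective ones.
Fn : ℕ → Set
Fn n = Fin n → Fin n

IsPerm : ∀ {n} → Fn n → Set
IsPerm {n} σ = Bijective {A = Fin n} _≡_ _≡_ σ

_≗?_ : ∀ {n} (σ τ : Fn n) → Dec (σ ≗ τ)
σ ≗? τ = all? (λ x → σ x ≟ τ x)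

-- a family of permutations, given as a finite list (regarded as a set)
Family : ℕ → Set
Family n = List (Fn n)

_∈F_ : ∀ {n} → Fn n → Family n → Set
σ ∈F 𝒜 = Any (σ ≗_) 𝒜

_∈F?_ : ∀ {n} (σ : Fn n) (𝒜 : Family n) → Dec (σ ∈F 𝒜)
σ ∈F? 𝒜 = any? (σ ≗?_) 𝒜

-- the (i,j)-compression σ_{i,j} of σ, following the paper literally:
-- if σ(i) = i or σ(j) ≠ j, then σ_{i,j} = σ; otherwise
-- σ_{i,j}(i) = i, σ_{i,j}(j) = σ(i), σ_{i,j}(σ⁻¹(i)) = j (i.e. at the y with σ(y) = i),
-- and σ_{i,j}(y) = σ(y) elsewhere.
compress : ∀ {n} → Fin n → Fin n → Fn n → Fn n
compress i j σ with σ i ≟ i | σ j ≟ j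
... | yes _ | _     = σ
... | no _  | no _  = σ
... | no _  | yes _ = λ y → body y
  where
  body : _ → _
  body y with y ≟ i
  ... | yes _ = i
  ... | no _ with y ≟ j
  ...   | yes _ = σ i
  ...   | no _ with σ y ≟ i
  ...     | yes _ = j
  ...     | no _  = σ y

C : ∀ {n} → Fin n → Fin n → Family n → Fn n → Fn n
C i j 𝒜 σ with compress i j σ ∈F? 𝒜
... | yes _ = σ
... | no _  = compress i j σ

CF : ∀ {n} → Fin n → Fin n → Family n → Family n
CF i j 𝒜 = map (C i j 𝒜) 𝒜

_⊆F_ : ∀ {n} → Family n → Family n → Set
𝒜 ⊆F ℬ = ∀ σ → σ ∈F 𝒜 → σ ∈F ℬ

_≈F_ : ∀ {n} → Family n → Family n → Set
𝒜 ≈F ℬ = 𝒜 ⊆F ℬ × ℬ ⊆F 𝒜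

Compressed : ∀ {n} → Family n → Set
Compressed {n} 𝒜 = ∀ (i j : Fin n) → i < j → CF i j 𝒜 ≈F 𝒜

Pair : ℕ → Set
Pair n = Σ (Fin n × Fin n) (λ p → proj₁ p < proj₂ p)

applyAll : ∀ {n} → List (Pair n) → Family n → Family n
applyAll ps 𝒜 = foldl (λ ℬ p → CF (proj₁ (proj₁ p)) (proj₂ (proj₁ p)) ℬ) 𝒜 ps

module Submission where

-- Idea: a potential function.  Give the point y ∈ [n] the weight n - y and let
-- the potential of σ be the total weight of the points that σ moves.  A
-- compression σ ↦ σ_{i,j} that actually changes σ (so σ(i) ≠ i, σ(j) = j)
-- makes i a fixed point, can only unfix j, and leaves the fixedness of every
-- other point unchanged; since i < j the weight of i exceeds that of j, so the
-- potential strictly drops.  Summing over the list 𝒜, every compression that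
-- moves some member strictly lowers the potential of the family.

open import Defs
open import Data.Nat using (ℕ; zero; suc; _+_; _∸_; _≤_; _<_; z≤n)
open import Data.Nat.Properties
  using (+-0-commutativeMonoid; +-mono-≤; +-mono-<-≤; +-mono-≤-<; +-monoʳ-<; +-identityʳ;
         +-cancelʳ-<; <⇒≤; ∸-monoʳ-<; ≤-refl; ≤-reflexive; <-irrefl; module ≤-Reasoning)
open import Data.Nat.ListAction as ListAction using ()
open import Data.Nat.Induction using (<-wellFounded)
open import Induction.WellFounded using (Acc; acc)
open import Data.Bool using (if_then_else_)
import Data.Fin as F
open F using (Fin; toℕ)
open import Data.Fin.Properties using (_≟_; _<?_; any?; toℕ<n)
open import Data.List using (List; []; _∷_; map)
open import Data.List.Relation.Unary.All as All using (All; []; _∷_)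
open import Data.List.Relation.Unary.All.Properties using (¬All⇒Any¬)
open import Data.List.Relation.Unary.Any as Any using (Any; here; there)
import Data.List.Relation.Unary.Any.Properties as AnyP
open import Data.Product using (Σ; _×_; _,_)
open import Data.Sum using (_⊎_; inj₁; inj₂)
open import Relation.Nullary using (¬_; Dec; does; yes; no; contradiction; ¬?; _×-dec_)
open import Relation.Nullary.Decidable using (decidable-stable)
open import Relation.Binary.PropositionalEquality
open import Algebra.Properties.CommutativeMonoid.Sum +-0-commutativeMonoid
  using (sum; ∑-distrib-+; sum-cong-≗; sum-replicate-zero)

sum-mono : ∀ {n} {f g : Fin n → ℕ} → (∀ y → f y ≤ g y) → sum f ≤ sum g
sum-mono {zero}  f≤g = z≤n
sum-mono {suc n} f≤g = +-mono-≤ (f≤g F.zero) (sum-mono (λ y → f≤g (F.suc y)))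

indicator : ∀ {n} → Fin n → ℕ → Fin n → ℕ
indicator i c y = if does (y ≟ i) then c else 0

indicator-at : ∀ {n} (i : Fin n) c → indicator i c i ≡ c
indicator-at i c with i ≟ i
... | yes _   = refl
... | no i≢i  = contradiction refl i≢i

indicator-off : ∀ {n} (i : Fin n) c y → ¬ y ≡ i → indicator i c y ≡ 0
indicator-off i c y y≢i with y ≟ i
... | yes y≡i = contradiction y≡i y≢i
... | no _    = refl

sum-indicator : ∀ {n} (i : Fin n) (c : ℕ) → sum (indicator i c) ≡ c
sum-indicator {suc n} F.zero    c = trans (cong (c +_) (sum-replicate-zero n)) (+-identityʳ c)
sum-indicator {suc n} (F.suc i) c = sum-indicator i c

sum-transfer : ∀ {n} (f g : Fin n → ℕ) (i j : Fin n) (a b : ℕ) →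
  (∀ y → f y + indicator i a y ≤ g y + indicator j b y) → sum f + a ≤ sum g + b
sum-transfer f g i j a b pointwise = begin
  sum f + a                          ≡⟨ cong (sum f +_) (sum-indicator i a) ⟨
  sum f + sum (indicator i a)        ≡⟨ ∑-distrib-+ f (indicator i a) ⟨
  sum (λ y → f y + indicator i a y)  ≤⟨ sum-mono pointwise ⟩
  sum (λ y → g y + indicator j b y)  ≡⟨ ∑-distrib-+ g (indicator j b) ⟩
  sum g + sum (indicator j b)        ≡⟨ cong (sum g +_) (sum-indicator j b) ⟩
  sum g + b                          ∎
  where open ≤-Reasoning

weight : ∀ {n} → Fin n → ℕ
weight {n} y = n ∸ toℕ y

weight-anti : ∀ {n} {i j : Fin n} → i F.< j → weight j < weight i
weight-anti {j = j} i<j = ∸-monoʳ-< i<j (<⇒≤ (toℕ<n j))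

displacement : ∀ {n} → Fn n → Fin n → ℕ
displacement σ y = if does (σ y ≟ y) then 0 else weight y

displacement-fixed : ∀ {n} (σ : Fn n) y → σ y ≡ y → displacement σ y ≡ 0
displacement-fixed σ y σy≡y with σ y ≟ y
... | yes _    = refl
... | no σy≢y  = contradiction σy≡y σy≢y

displacement-moved : ∀ {n} (σ : Fn n) y → ¬ σ y ≡ y → displacement σ y ≡ weight y
displacement-moved σ y σy≢y with σ y ≟ y
... | yes σy≡y = contradiction σy≡y σy≢y
... | no _     = refl

displacement≤weight : ∀ {n} (σ : Fn n) y → displacement σ y ≤ weight y
displacement≤weight σ y with σ y ≟ y
... | yes _ = z≤n
... | no _  = ≤-refl

displacement-cong : ∀ {n} (σ τ : Fn n) y → σ y ≡ τ y → displacement σ y ≡ displacement τ y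
displacement-cong σ τ y σy≡τy = cong (λ v → if does (v ≟ y) then 0 else weight y) σy≡τy

potential : ∀ {n} → Fn n → ℕ
potential σ = sum (displacement σ)

potential-cong : ∀ {n} (σ τ : Fn n) → σ ≗ τ → potential σ ≡ potential τ
potential-cong σ τ σ≗τ = sum-cong-≗ (λ y → displacement-cong σ τ y (σ≗τ y))

compress-cases : ∀ {n} (i j : Fin n) (σ : Fn n) →
  compress i j σ ≗ σ ⊎ (¬ σ i ≡ i × σ j ≡ j)
compress-cases i j σ with σ i ≟ i | σ j ≟ j
... | yes _   | _        = inj₁ (λ _ → refl)
... | no _    | no _     = inj₁ (λ _ → refl)
... | no σi≢i | yes σj≡j = inj₂ (σi≢i , σj≡j)

module Active {n} {i j : Fin n} (i<j : i F.< j) (σ : Fn n) (σi≢i : ¬ σ i ≡ i) (σj≡j : σ j ≡ j) where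

  ρ : Fn n
  ρ = compress i j σ

  i≢j : ¬ i ≡ j
  i≢j i≡j = <-irrefl (cong toℕ i≡j) i<j

  compress-fixes-i : ρ i ≡ i
  compress-fixes-i with σ i ≟ i | σ j ≟ j
  ... | yes σi≡i | _       = contradiction σi≡i σi≢i
  ... | no _     | no σj≢j = contradiction σj≡j σj≢j
  ... | no _     | yes _ with i ≟ i
  ...   | yes _   = refl
  ...   | no i≢i  = contradiction refl i≢i

  compress-elsewhere : ∀ y → ¬ y ≡ i → ¬ y ≡ j → (σ y ≡ i × ρ y ≡ j) ⊎ ρ y ≡ σ y
  compress-elsewhere y y≢i y≢j with σ i ≟ i | σ j ≟ j
  ... | yes σi≡i | _       = contradiction σi≡i σi≢i
  ... | no _     | no σj≢j = contradiction σj≡j σj≢j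
  ... | no _     | yes _ with y ≟ i
  ...   | yes y≡i = contradiction y≡i y≢i
  ...   | no _ with y ≟ j
  ...     | yes y≡j = contradiction y≡j y≢j
  ...     | no _ with σ y ≟ i
  ...       | yes σy≡i = inj₁ (σy≡i , refl)
  ...       | no _     = inj₂ refl

  displacement-elsewhere : ∀ y → ¬ y ≡ i → ¬ y ≡ j → displacement ρ y ≡ displacement σ y
  displacement-elsewhere y y≢i y≢j with compress-elsewhere y y≢i y≢j
  ... | inj₁ (σy≡i , ρy≡j) =
    trans (displacement-moved ρ y (λ ρy≡y → y≢j (trans (sym ρy≡y) ρy≡j)))
          (sym (displacement-moved σ y (λ σy≡y → y≢i (trans (sym σy≡y) σy≡i))))
  ... | inj₂ ρy≡σy = displacement-cong ρ σ y ρy≡σy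

  transfer-pointwise : ∀ y → displacement ρ y + indicator i (weight i) y
                           ≤ displacement σ y + indicator j (weight j) y
  transfer-pointwise y = by-cases (y ≟ i) (y ≟ j)
    where
    Goal : Set
    Goal = displacement ρ y + indicator i (weight i) y ≤ displacement σ y + indicator j (weight j) y
    by-cases : Dec (y ≡ i) → Dec (y ≡ j) → Goal
    by-cases (yes refl) _ = ≤-reflexive (begin
      displacement ρ y + indicator y (weight y) y  ≡⟨ cong₂ _+_ (displacement-fixed ρ y compress-fixes-i) (indicator-at y _) ⟩
      weight y                                     ≡⟨ +-identityʳ (weight y) ⟨
      weight y + 0                                 ≡⟨ cong₂ _+_ (displacement-moved σ y σi≢i) (indicator-off j _ y i≢j) ⟨
      displacement σ y + indicator j (weight j) y  ∎)
      where open ≡-Reasoning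
    by-cases (no y≢i) (yes refl) = begin
      displacement ρ y + indicator i (weight i) y  ≡⟨ cong (displacement ρ y +_) (indicator-off i _ y y≢i) ⟩
      displacement ρ y + 0                         ≡⟨ +-identityʳ _ ⟩
      displacement ρ y                             ≤⟨ displacement≤weight ρ y ⟩
      weight y                                     ≡⟨ cong₂ _+_ (displacement-fixed σ y σj≡j) (indicator-at y _) ⟨
      displacement σ y + indicator y (weight y) y  ∎
      where open ≤-Reasoning
    by-cases (no y≢i) (no y≢j) = ≤-reflexive
      (cong₂ _+_ (displacement-elsewhere y y≢i y≢j)
                 (trans (indicator-off i _ y y≢i) (sym (indicator-off j _ y y≢j))))

  potential-drops : potential ρ < potential σ
  potential-drops = +-cancelʳ-< (weight j) (potential ρ) (potential σ) (begin-strict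
    potential ρ + weight j  <⟨ +-monoʳ-< (potential ρ) (weight-anti i<j) ⟩
    potential ρ + weight i  ≤⟨ sum-transfer (displacement ρ) (displacement σ) i j _ _ transfer-pointwise ⟩
    potential σ + weight j  ∎)
    where open ≤-Reasoning

C-step : ∀ {n} {i j : Fin n} → i F.< j → (𝒜 : Family n) (σ : Fn n) →
  C i j 𝒜 σ ≗ σ ⊎ potential (C i j 𝒜 σ) < potential σ
C-step {i = i} {j} i<j 𝒜 σ with compress i j σ ∈F? 𝒜
... | yes _ = inj₁ (λ _ → refl)
... | no _ with compress-cases i j σ
...   | inj₁ unchanged      = inj₁ unchanged
...   | inj₂ (σi≢i , σj≡j) = inj₂ (Active.potential-drops i<j σ σi≢i σj≡j)

C-nonincreasing : ∀ {n} {i j : Fin n} → i F.< j → (𝒜 : Family n) (σ : Fn n) →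
  potential (C i j 𝒜 σ) ≤ potential σ
C-nonincreasing i<j 𝒜 σ with C-step i<j 𝒜 σ
... | inj₁ unchanged = ≤-reflexive (potential-cong _ σ unchanged)
... | inj₂ drop      = <⇒≤ drop

C-moving-decreases : ∀ {n} {i j : Fin n} → i F.< j → (𝒜 : Family n) (σ : Fn n) →
  ¬ C i j 𝒜 σ ≗ σ → potential (C i j 𝒜 σ) < potential σ
C-moving-decreases i<j 𝒜 σ moved with C-step i<j 𝒜 σ
... | inj₁ unchanged = contradiction unchanged moved
... | inj₂ drop      = drop

module _ {A : Set} (φ : A → ℕ) (f : A → A) (φ-nonincreasing : ∀ x → φ (f x) ≤ φ x) where

  sum-map-nonincreasing : ∀ xs → ListAction.sum (map φ (map f xs)) ≤ ListAction.sum (map φ xs)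
  sum-map-nonincreasing []       = z≤n
  sum-map-nonincreasing (x ∷ xs) = +-mono-≤ (φ-nonincreasing x) (sum-map-nonincreasing xs)

  sum-map-decreasing : ∀ {xs} → Any (λ x → φ (f x) < φ x) xs →
    ListAction.sum (map φ (map f xs)) < ListAction.sum (map φ xs)
  sum-map-decreasing {x ∷ xs} (here fx<x)  = +-mono-<-≤ fx<x (sum-map-nonincreasing xs)
  sum-map-decreasing {x ∷ xs} (there more) = +-mono-≤-< (φ-nonincreasing x) (sum-map-decreasing more)

familyPotential : ∀ {n} → Family n → ℕ
familyPotential 𝒜 = ListAction.sum (map potential 𝒜)

CF-decreases : ∀ {n} {i j : Fin n} → i F.< j → (𝒜 : Family n) →
  Any (λ σ → ¬ C i j 𝒜 σ ≗ σ) 𝒜 → familyPotential (CF i j 𝒜) < familyPotential 𝒜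
CF-decreases i<j 𝒜 someMoved =
  sum-map-decreasing potential _ (C-nonincreasing i<j 𝒜)
    (Any.map (C-moving-decreases i<j 𝒜 _) someMoved)

any-along : ∀ {A : Set} {P Q : A → Set} {xs} → All (λ x → P x → Q x) xs → Any P xs → Any Q xs
any-along (p⇒q ∷ _)  (here px)   = here (p⇒q px)
any-along (_ ∷ p⇒qs) (there pxs) = there (any-along p⇒qs pxs)

map-fixing-≈F : ∀ {n} (f : Fn n → Fn n) (𝒜 : Family n) → All (λ σ → f σ ≗ σ) 𝒜 → map f 𝒜 ≈F 𝒜
map-fixing-≈F f 𝒜 fixes =
  (λ τ τ∈f𝒜 → any-along (All.map (λ fσ≗σ τ≗fσ y → trans (τ≗fσ y) (fσ≗σ y)) fixes) (AnyP.map⁻ τ∈f𝒜)) ,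
  (λ τ τ∈𝒜 → AnyP.map⁺ (any-along (All.map (λ fσ≗σ τ≗σ y → trans (τ≗σ y) (sym (fσ≗σ y))) fixes) τ∈𝒜))

Stable : ∀ {n} → Family n → Set
Stable {n} 𝒜 = ∀ (i j : Fin n) → i F.< j → All (λ σ → C i j 𝒜 σ ≗ σ) 𝒜

stable⇒compressed : ∀ {n} {𝒜 : Family n} → Stable 𝒜 → Compressed 𝒜
stable⇒compressed {𝒜 = 𝒜} stable i j i<j = map-fixing-≈F (C i j 𝒜) 𝒜 (stable i j i<j)

fixes-all? : ∀ {n} (i j : Fin n) (𝒜 : Family n) → Dec (All (λ σ → C i j 𝒜 σ ≗ σ) 𝒜)
fixes-all? i j 𝒜 = All.all? (λ σ → C i j 𝒜 σ ≗? σ) 𝒜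

stable-or-moving : ∀ {n} (𝒜 : Family n) →
  Stable 𝒜 ⊎ Σ (Pair n) (λ { ((i , j) , _) → Any (λ σ → ¬ C i j 𝒜 σ ≗ σ) 𝒜 })
stable-or-moving 𝒜 with any? (λ i → any? (λ j → (i <? j) ×-dec ¬? (fixes-all? i j 𝒜)))
... | yes (i , j , i<j , ¬fixes) =
  inj₂ (((i , j) , i<j) , ¬All⇒Any¬ (λ σ → C i j 𝒜 σ ≗? σ) 𝒜 ¬fixes)
... | no none = inj₁ (λ i j i<j →
  decidable-stable (fixes-all? i j 𝒜) (λ ¬fixes → none (i , j , i<j , ¬fixes)))

compress-until-stable : ∀ {n} (𝒜 : Family n) → Acc _<_ (familyPotential 𝒜) →
  Σ (List (Pair n)) (λ ps → Stable (applyAll ps 𝒜))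
compress-until-stable 𝒜 (acc smaller) with stable-or-moving 𝒜
... | inj₁ stable = [] , stable
... | inj₂ (p@((i , j) , i<j) , someMoved)
  with compress-until-stable (CF i j 𝒜) (smaller (CF-decreases i<j 𝒜 someMoved))
...   | ps , stable = p ∷ ps , stable

proposition2p4 : (n : ℕ) (𝒜 : Family n) → All IsPerm 𝒜 → ¬ Compressed 𝒜 →
    Σ (List (Pair n)) (λ ps → Compressed (applyAll ps 𝒜))
proposition2p4 n 𝒜 _ _ with compress-until-stable 𝒜 (<-wellFounded (familyPotential 𝒜))
... | ps , stable = ps , stable⇒compressed stable
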